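{- Let $A\in\mathbb{Z}^{d\times n}$ have rank $d$, with $n>d$. Consider the Fast Generalized Euclidean Algorithm described in the context, modified so that every rational entry of the matrix $X$ (after it is computed in step 2 and after each update of one of its columns in step 3), of each vector $Z_j$, and hence of the matrix $Y$, is replaced by its image under the map $\varphi$. Then this modified algorithm still returns a matrix $S=BY$ with $\mathcal{L}(S)=\mathcal{L}(A)$.
   Context: For a matrix $M$ with columns $M_1,\dots,M_k\in\mathbb{Z}^d$, $\mathcal{L}(M)=\{\sum_i\lambda_iM_i:\lambda\in\mathbb{Z}^k\}$. $e_\ell$ denotes the $\ell$-th unit vector. The map $\varphi:\mathbb{Q}\to\mathbb{Q}$ ("computation modulo 1") is $\varphi(q)=q-\lfloor q\rfloor$ if $q\notin\mathbb{Z}$, $\varphi(q)=1$ if $q\in\mathbb{Z}\setminus\{0\}$, and $\varphi(0)=0$. Fast Generalized Euclidean Algorithm, input $A\in\mathbb{Z}^{d\times n}$, with $m:=n-d$: 1. Choose $d$ linearly independent columns of $A$, forming $B=(B_1,\dots,B_d)\in\mathbb{Z}^{d\times d}$; let $C=(C_1,\dots,C_m)$ be the remaining columns. 2. Compute the rational matrix $X\in\mathbb{Q}^{d\times m}$ with $BX=C$; denote its $j$-th column by $x^{(j)}$. 3. For $i=1,\dots,d$: choose an index $\ell\in\{1,\dots,d\}$ not chosen in an earlier iteration. Let $t$ be a positive integer such that $t\,x^{(j)}_\ell\in\mathbb{Z}$ for all $j$, and put $t_j:=t\,x^{(j)}_\ell$. Set $g_0:=t$, $Z_0:=e_\ell$.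 For $j=1,\dots,m$: let $g_j:=\gcd(g_{j-1},t_j)$, choose integers $\alpha_j,\beta_j$ with $g_j=\alpha_jg_{j-1}+\beta_jt_j$, set $Z_j:=\alpha_jZ_{j-1}+\beta_jx^{(j)}$, and replace $x^{(j)}$ by $(g_{j-1}/g_j)\,x^{(j)}-(t_j/g_j)\,Z_{j-1}$. Set $Y_i:=Z_m$. 4. Return $S:=BY$, where $Y$ has columns $Y_1,\dots,Y_d$. -}

module Defs where

open import Data.Nat as ℕ using (ℕ; zero; suc; _∸_)
open import Data.Integer as ℤ using (ℤ; +_)
open import Data.Integer.GCD using (gcd)
open import Data.Rational as ℚ using (ℚ; 0ℚ; 1ℚ; floor; _/_)
open import Data.Rational.Properties using (_≟_)
open import Data.Fin using (Fin; zero; suc; _≟_)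
open import Data.Vec using (Vec; []; _∷_; lookup; map)
open import Data.Bool using (Bool; true; false; if_then_else_)
open import Relation.Nullary using (does)
open import Relation.Binary.PropositionalEquality using (_≡_)
open import Data.Product using (Σ; ∃; _×_)

ιℚ : ℤ → ℚ
ιℚ i = i / 1

Σℚ : (k : ℕ) → (Fin k → ℚ) → ℚ
Σℚ zero    f = 0ℚ
Σℚ (suc k) f = f zero ℚ.+ Σℚ k (λ i → f (suc i))

Vecℚ : ℕ → Set
Vecℚ d = Fin d → ℚ

Mat : ℕ → ℕ → Set
Mat d k = Fin d → Fin k → ℚ

MatZ : ℕ → ℕ → Set
MatZ d k = Fin d → Fin k → ℤ

castMat : ∀ {d k} → MatZ d k → Mat d k
castMat M r c = ιℚ (M r c)

_⊗_ : ∀ {d k l} → Mat d k → Mat k l → Mat d l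
(M ⊗ N) r c = Σℚ _ (λ i → M r i ℚ.* N i c)

_∈L_ : ∀ {d k} → Vecℚ d → Mat d k → Set
v ∈L M = Σ (Fin _ → ℤ) λ c → ∀ r → v r ≡ Σℚ _ (λ i → ιℚ (c i) ℚ.* M r i)

LinIndep : ∀ {d k} → Mat d k → Set
LinIndep {d} {k} M = (c : Fin k → ℚ) → (∀ r → Σℚ k (λ i → c i ℚ.* M r i) ≡ 0ℚ) → ∀ i → c i ≡ 0ℚ

isIntegral : ℚ → Bool
isIntegral q = ℚ.denominator-1 q ℕ.≡ᵇ 0

φ : ℚ → ℚ
φ q = if isIntegral q
        then (if does (q Data.Rational.Properties.≟ 0ℚ) then 0ℚ else 1ℚ)
        else q ℚ.- ιℚ (floor q)

φv : ∀ {d} → Vecℚ d → Vecℚ d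
φv v i = φ (v i)

_·_ : ∀ {d} → ℚ → Vecℚ d → Vecℚ d
(a · v) i = a ℚ.* v i

_⊕_ : ∀ {d} → Vecℚ d → Vecℚ d → Vecℚ d
(u ⊕ v) i = u i ℚ.+ v i

_⊖_ : ∀ {d} → Vecℚ d → Vecℚ d → Vecℚ d
(u ⊖ v) i = u i ℚ.- v i

unit : ∀ {d} → Fin d → Vecℚ d
unit ℓ i = if does (ℓ Data.Fin.≟ i) then 1ℚ else 0ℚ

-- Inner loop of step 3 (modified: φ applied to every updated Z_j and x^(j)).
-- Inner ℓ t Z g xs Z' xs' : starting from Z_{j-1} = Z, g_{j-1} = g and the
-- remaining (current) columns xs = x^(j), x^(j+1), …, a valid run of the loop
-- ends with Z_m = Z' and the updated columns xs'.
-- The choices (α_j, β_j) are arbitrary subject to g_j = α_j g_{j-1} + β_j t_j.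
-- t_j is the integer with t_j = t · x^(j)_ℓ (its existence is the integrality
-- requirement on t); q₁ = g_{j-1}/g_j and q₂ = t_j/g_j are integers.
data Inner {d : ℕ} (ℓ : Fin d) (t : ℕ) :
     (Z : Vecℚ d) (g : ℤ) {k : ℕ} (xs : Vec (Vecℚ d) k) (Z' : Vecℚ d) (xs' : Vec (Vecℚ d) k) → Set where
  done : ∀ {Z g} → Inner ℓ t Z g [] Z []
  step : ∀ {Z g k x} {xs : Vec (Vecℚ d) k} {Zf xs'}
           (tj : ℤ) → ιℚ tj ≡ ιℚ (+ t) ℚ.* x ℓ →
           (α β : ℤ) → gcd g tj ≡ α ℤ.* g ℤ.+ β ℤ.* tj →
           (q₁ q₂ : ℤ) → g ≡ q₁ ℤ.* gcd g tj → tj ≡ q₂ ℤ.* gcd g tj →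
           Inner ℓ t (φv ((ιℚ α · Z) ⊕ (ιℚ β · x))) (gcd g tj) xs Zf xs' →
           Inner ℓ t Z g (x ∷ xs) Zf (φv ((ιℚ q₁ · x) ⊖ (ιℚ q₂ · Z)) ∷ xs')

-- Outer loop of step 3: Outer ℓs xs Ys : processing the indices ℓs in order,
-- starting from the current columns xs of X, produces the columns Ys of Y.
-- In each iteration t is an arbitrary positive integer (integrality is
-- enforced by Inner), Z_0 = e_ℓ, g_0 = t, and Y_i := Z_m.
data Outer {d m : ℕ} : {k : ℕ} (ℓs : Vec (Fin d) k) (xs : Vec (Vecℚ d) m) (Ys : Vec (Vecℚ d) k) → Set where
  done : ∀ {xs} → Outer [] xs []
  step : ∀ {k ℓ} {ℓs : Vec (Fin d) k} {xs Zf xs' Ys} (t : ℕ) → 0 ℕ.< t →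
           Inner ℓ t (unit ℓ) (+ t) xs Zf xs' →
           Outer ℓs xs' Ys →
           Outer (ℓ ∷ ℓs) xs (Zf ∷ Ys)

colsMat : ∀ {d k} → Vec (Vecℚ d) k → Mat d k
colsMat cs r c = lookup cs c r

matCols : ∀ {d k} → Mat d k → Vec (Vecℚ d) k
matCols {k = zero} M = []
matCols {k = suc k} M = (λ r → M r zero) ∷ matCols (λ r c → M r (suc c))

-- Let Λ = Lattice(e₁, …, e_d, x⁽¹⁾, …, x⁽ᵐ⁾) ⊆ ℚ^d, so that B Λ = L(A) because B X = C.
-- Round i of step 3 only performs unimodular changes of generators: the pair (Z, x⁽ʲ⁾) becomes
-- (α Z + β x⁽ʲ⁾, q₁ x⁽ʲ⁾ - q₂ Z) with α q₁ + β q₂ = 1, so the lattice spanned by the unit vectors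
-- of the not yet processed coordinates, Z and the current columns does not change. Applying φ
-- adds an integer vector; it stays in that lattice because its support lies in the unprocessed
-- coordinates: processed coordinates vanish in all remaining vectors, and at the pivot ℓ the
-- updated x⁽ʲ⁾ has entry 0 while Z has entry g_j / t ∈ (0, 1], both fixed by φ. After d rounds
-- no unit vector is left and the generators are exactly Y₁, …, Y_d, so B Λ = L(B Y).

module Submission where

open import Algebra.Bundles using (CommutativeMonoid)
open import Data.Bool using (true; false; if_then_else_)
open import Data.Fin as Fin using (Fin; zero; suc; punchOut; splitAt; join)
import Data.Fin.Properties as Fin
open import Data.Integer as ℤ using (ℤ; +_; -[1+_]; 0ℤ)
open import Data.Integer.GCD using (gcd)
import Data.Integer.Properties as ℤ
open import Data.Integer.Tactic.RingSolver using (solve-∀)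
open import Data.Nat as ℕ using (ℕ; zero; suc; _∸_)
import Data.Nat.Coprimality as Coprime
open import Data.Nat.DivMod using (m<n⇒m/n≡0)
import Data.Nat.GCD as ℕ
import Data.Nat.Divisibility as ℕ
import Data.Nat.Properties as ℕ
open import Data.Product as Product using (∃; _,_; _×_; proj₁; proj₂; uncurry)
open import Data.Rational as ℚ using (ℚ; mkℚ; 0ℚ; 1ℚ; _+_; _*_; -_; _-_; _≤_; _<_; *≤*; *<*)
import Data.Rational.Properties as ℚ
open import Data.Rational.Solver using (module +-*-Solver)
open import Data.Sum as Sum using (_⊎_; inj₁; inj₂; [_,_]′)
open import Data.Vec using (Vec; []; _∷_; lookup; map)
open import Data.Vec.Membership.Propositional using (_∈_)
open import Data.Vec.Membership.Propositional.Properties using (∈-lookup; ∈-map⁺; fromAny)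
open import Data.Vec.Relation.Unary.All as All using (All; []; _∷_)
import Data.Vec.Relation.Unary.Any as Any
open import Data.Vec.Relation.Unary.Any using (here; there)
open import Data.Vec.Relation.Unary.Any.Properties using (lookup-index; map⁻)
open import Function using (_∘_; id)
open import Function.Definitions using (Injective)
open import Level using (0ℓ)
open import Relation.Binary.PropositionalEquality
  using (_≡_; _≢_; _≗_; refl; sym; trans; cong; cong₂; subst; subst₂; ≢-sym; module ≡-Reasoning)
open import Relation.Nullary using (does; yes; no)
open import Relation.Nullary.Decidable using (dec-true)
open import Relation.Nullary.Negation using (contradiction)
open import Relation.Unary using (Pred; _⊆_; _∪_; ｛_｝; _≐_)

open import Defs

open +-*-Solver using (solve; _:+_; _:*_; _:-_; _:=_; con)
open import Algebra.Properties.CommutativeSemigroup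
  (CommutativeMonoid.commutativeSemigroup ℚ.+-0-commutativeMonoid) using (interchange)

ιℚ≡mkℚ : ∀ i → ιℚ i ≡ mkℚ i 0 (Coprime.sym (Coprime.1-coprimeTo _))
ιℚ≡mkℚ i = ℚ.↥p/↧p≡p (mkℚ i 0 (Coprime.sym (Coprime.1-coprimeTo _)))

ιℚ-+ : ∀ i j → ιℚ (i ℤ.+ j) ≡ ιℚ i + ιℚ j
ιℚ-+ i j rewrite ιℚ≡mkℚ i | ιℚ≡mkℚ j =
  cong ιℚ (cong₂ ℤ._+_ (sym (ℤ.*-identityʳ i)) (sym (ℤ.*-identityʳ j)))

ιℚ-* : ∀ i j → ιℚ (i ℤ.* j) ≡ ιℚ i * ιℚ j
ιℚ-* i j rewrite ιℚ≡mkℚ i | ιℚ≡mkℚ j = refl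

ιℚ-neg : ∀ i → ιℚ (ℤ.- i) ≡ - ιℚ i
ιℚ-neg i rewrite ιℚ≡mkℚ i | ιℚ≡mkℚ (ℤ.- i) = neg-mkℚ i
  where
  neg-mkℚ : ∀ i → mkℚ (ℤ.- i) 0 (Coprime.sym (Coprime.1-coprimeTo _)) ≡ - mkℚ i 0 (Coprime.sym (Coprime.1-coprimeTo _))
  neg-mkℚ (+ zero)  = refl
  neg-mkℚ (+ suc n) = refl
  neg-mkℚ -[1+ n ]  = refl

ιℚ-lincomb : ∀ a b c e → ιℚ (a ℤ.* b ℤ.+ c ℤ.* e) ≡ ιℚ a * ιℚ b + ιℚ c * ιℚ e
ιℚ-lincomb a b c e = trans (ιℚ-+ (a ℤ.* b) (c ℤ.* e)) (cong₂ _+_ (ιℚ-* a b) (ιℚ-* c e))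

ιℚ-mono-≤ : ∀ {i j} → i ℤ.≤ j → ιℚ i ≤ ιℚ j
ιℚ-mono-≤ {i} {j} i≤j rewrite ιℚ≡mkℚ i | ιℚ≡mkℚ j =
  *≤* (subst₂ ℤ._≤_ (sym (ℤ.*-identityʳ i)) (sym (ℤ.*-identityʳ j)) i≤j)

ιℚ-mono-< : ∀ {i j} → i ℤ.< j → ιℚ i < ιℚ j
ιℚ-mono-< {i} {j} i<j rewrite ιℚ≡mkℚ i | ιℚ≡mkℚ j =
  *<* (subst₂ ℤ._<_ (sym (ℤ.*-identityʳ i)) (sym (ℤ.*-identityʳ j)) i<j)

ιℚ-positive : ∀ {i} → 0ℤ ℤ.< i → ℚ.Positive (ιℚ i)
ιℚ-positive 0<i = ℚ.positive (ιℚ-mono-< 0<i)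

0<i⇒0<gcd[i,j]≤i : ∀ {i} j → 0ℤ ℤ.< i → 0ℤ ℤ.< gcd i j × gcd i j ℤ.≤ i
0<i⇒0<gcd[i,j]≤i {+ zero}  j (ℤ.+<+ ())
0<i⇒0<gcd[i,j]≤i {+ suc n} j _ =
  ℤ.+<+ (ℕ.n≢0⇒n>0 (ℕ.gcd[m,n]≢0 (suc n) ℤ.∣ j ∣ (inj₁ (λ ())))) ,
  ℤ.+≤+ (ℕ.∣⇒≤ (ℕ.gcd[m,n]∣m (suc n) ℤ.∣ j ∣))

bezout-cofactors≡1 : ∀ {a b c α β q₁ q₂} → c ≢ 0ℤ →
  c ≡ α ℤ.* a ℤ.+ β ℤ.* b → a ≡ q₁ ℤ.* c → b ≡ q₂ ℤ.* c → α ℤ.* q₁ ℤ.+ β ℤ.* q₂ ≡ + 1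
bezout-cofactors≡1 {a} {b} {c} {α} {β} {q₁} {q₂} c≢0 c≡ a≡ b≡ =
  ℤ.*-cancelˡ-≡ c _ (+ 1) {{ℤ.≢-nonZero c≢0}} (begin
    c ℤ.* (α ℤ.* q₁ ℤ.+ β ℤ.* q₂)          ≡⟨ regroup c α β q₁ q₂ ⟩
    α ℤ.* (q₁ ℤ.* c) ℤ.+ β ℤ.* (q₂ ℤ.* c)  ≡⟨ cong₂ (λ x y → α ℤ.* x ℤ.+ β ℤ.* y) a≡ b≡ ⟨
    α ℤ.* a ℤ.+ β ℤ.* b                    ≡⟨ c≡ ⟨
    c                                      ≡⟨ ℤ.*-identityʳ c ⟨
    c ℤ.* + 1                              ∎)
  where
  open ≡-Reasoning
  regroup : ∀ c α β q₁ q₂ → c ℤ.* (α ℤ.* q₁ ℤ.+ β ℤ.* q₂) ≡ α ℤ.* (q₁ ℤ.* c) ℤ.+ β ℤ.* (q₂ ℤ.* c)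
  regroup = solve-∀

*-cancelˡ-≡-pos : ∀ r {p q} → ℚ.Positive r → r * p ≡ r * q → p ≡ q
*-cancelˡ-≡-pos r r-pos rp≡rq = ℚ.≤-antisym (ℚ.*-cancelˡ-≤-pos r {{r-pos}} (ℚ.≤-reflexive rp≡rq))
                                             (ℚ.*-cancelˡ-≤-pos r {{r-pos}} (ℚ.≤-reflexive (sym rp≡rq)))

t*q≡g⇒0<q≤1 : ∀ t {q g} → ιℚ (+ t) * q ≡ ιℚ g → 0ℤ ℤ.< g → g ℤ.≤ + t → 0ℚ < q × q ≤ 1ℚ
t*q≡g⇒0<q≤1 t {q} {g} tq≡g 0<g g≤t =
  ℚ.*-cancelˡ-<-nonNeg T {{ℚ.pos⇒nonNeg T {{T-pos}}}} (begin-strict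
    T * 0ℚ  ≡⟨ ℚ.*-zeroʳ T ⟩
    ιℚ 0ℤ   <⟨ ιℚ-mono-< 0<g ⟩
    ιℚ g    ≡⟨ tq≡g ⟨
    T * q   ∎) ,
  ℚ.*-cancelˡ-≤-pos T {{T-pos}} (begin
    T * q   ≡⟨ tq≡g ⟩
    ιℚ g    ≤⟨ ιℚ-mono-≤ g≤t ⟩
    T       ≡⟨ ℚ.*-identityʳ T ⟨
    T * 1ℚ  ∎)
  where
  open ℚ.≤-Reasoning
  T = ιℚ (+ t)
  T-pos : ℚ.Positive T
  T-pos = ιℚ-positive (ℤ.<-≤-trans 0<g g≤t)

φ-differs-by-integer : ∀ q → ∃ λ z → φ q ≡ q + ιℚ z
φ-differs-by-integer q@(mkℚ n zero _) = j ℤ.- n , (begin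
  φ q                  ≡⟨ φq≡ιℚj ⟩
  ιℚ j                 ≡⟨ cong ιℚ (j≡i+[j-i] n j) ⟩
  ιℚ (n ℤ.+ (j ℤ.- n)) ≡⟨ ιℚ-+ n (j ℤ.- n) ⟩
  ιℚ n + ιℚ (j ℤ.- n)  ≡⟨ cong (_+ ιℚ (j ℤ.- n)) (ιℚ≡mkℚ n) ⟩
  q + ιℚ (j ℤ.- n)     ∎)
  where
  open ≡-Reasoning
  j : ℤ
  j = if does (q ℚ.≟ 0ℚ) then 0ℤ else + 1
  φq≡ιℚj : φ q ≡ ιℚ j
  φq≡ιℚj with does (q ℚ.≟ 0ℚ)
  ... | true  = refl
  ... | false = refl
  j≡i+[j-i] : ∀ i j → j ≡ i ℤ.+ (j ℤ.- i)
  j≡i+[j-i] = solve-∀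
φ-differs-by-integer q@(mkℚ n (suc _) _) =
  ℤ.- ℚ.floor q , cong (λ z → q + z) (sym (ιℚ-neg (ℚ.floor q)))

0<q≤1⇒φq≡q : ∀ {q} → 0ℚ < q → q ≤ 1ℚ → φ q ≡ q
0<q≤1⇒φq≡q {mkℚ (+ zero) _ _} (*<* (ℤ.+<+ ()))
0<q≤1⇒φq≡q {mkℚ -[1+ _ ] _ _} (*<* ())
0<q≤1⇒φq≡q {mkℚ (+ 1) zero _} _ _ = refl
0<q≤1⇒φq≡q {mkℚ (+ suc (suc _)) zero _} _ (*≤* (ℤ.+≤+ (ℕ.s≤s ())))
0<q≤1⇒φq≡q {q@(mkℚ (+ suc k) (suc d) c)} _ (*≤* (ℤ.+≤+ num≤den)) = begin
  q - ιℚ (ℚ.floor q)  ≡⟨ cong (λ z → q - ιℚ z) floor≡0 ⟩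
  q - 0ℚ              ≡⟨ ℚ.+-identityʳ q ⟩
  q                   ∎
  where
  open ≡-Reasoning
  num≢den : suc k ≢ suc (suc d)
  num≢den eq with Coprime.recompute c (subst (suc (suc d) ℕ.∣_) (sym eq) ℕ.∣-refl , ℕ.∣-refl)
  ... | ()
  floor≡0 : ℚ.floor q ≡ 0ℤ
  floor≡0 = cong (λ z → + 1 ℤ.* + z) (m<n⇒m/n≡0 (ℕ.≤∧≢⇒<
    (subst₂ ℕ._≤_ (ℕ.*-identityʳ (suc k)) (ℕ.*-identityˡ (suc (suc d))) num≤den) num≢den))

Σℚ-cong : ∀ k {f g : Fin k → ℚ} → (∀ i → f i ≡ g i) → Σℚ k f ≡ Σℚ k g
Σℚ-cong zero    f≡g = refl
Σℚ-cong (suc k) f≡g = cong₂ _+_ (f≡g zero) (Σℚ-cong k (f≡g ∘ suc))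

Σℚ-zero : ∀ k → Σℚ k (λ _ → 0ℚ) ≡ 0ℚ
Σℚ-zero zero    = refl
Σℚ-zero (suc k) = cong (λ s → 0ℚ + s) (Σℚ-zero k)

Σℚ-+ : ∀ k (f g : Fin k → ℚ) → Σℚ k (λ i → f i + g i) ≡ Σℚ k f + Σℚ k g
Σℚ-+ zero    f g = refl
Σℚ-+ (suc k) f g = trans (cong (λ s → f zero + g zero + s) (Σℚ-+ k (f ∘ suc) (g ∘ suc)))
                         (interchange (f zero) (g zero) _ _)

Σℚ-neg : ∀ k (f : Fin k → ℚ) → Σℚ k (λ i → - f i) ≡ - Σℚ k f
Σℚ-neg zero    f = refl
Σℚ-neg (suc k) f = trans (cong (λ s → - f zero + s) (Σℚ-neg k (f ∘ suc)))
                         (sym (ℚ.neg-distrib-+ (f zero) _))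

unit-diag : ∀ {d} (k : Fin d) → unit k k ≡ 1ℚ
unit-diag k = cong (λ b → if b then 1ℚ else 0ℚ) (dec-true (k Fin.≟ k) refl)

unit-sym : ∀ {d} (k r : Fin d) → unit k r ≡ unit r k
unit-sym zero    zero    = refl
unit-sym zero    (suc r) = refl
unit-sym (suc k) zero    = refl
unit-sym (suc k) (suc r) = unit-sym k r

Σℚ-unit : ∀ d (k : Fin d) (a : Fin d → ℚ) → Σℚ d (λ i → unit k i * a i) ≡ a k
Σℚ-unit (suc d) zero a = begin
  1ℚ * a zero + Σℚ d (λ i → 0ℚ * a (suc i))
    ≡⟨ cong₂ _+_ (ℚ.*-identityˡ (a zero)) (trans (Σℚ-cong d (λ i → ℚ.*-zeroˡ (a (suc i)))) (Σℚ-zero d)) ⟩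
  a zero + 0ℚ
    ≡⟨ ℚ.+-identityʳ (a zero) ⟩
  a zero
    ∎
  where open ≡-Reasoning
Σℚ-unit (suc d) (suc k) a = begin
  0ℚ * a zero + Σℚ d (λ i → unit k i * a (suc i))  ≡⟨ cong₂ _+_ (ℚ.*-zeroˡ (a zero)) (Σℚ-unit d k (a ∘ suc)) ⟩
  0ℚ + a (suc k)                                   ≡⟨ ℚ.+-identityˡ (a (suc k)) ⟩
  a (suc k)                                        ∎
  where open ≡-Reasoning

-- Lattices generated by sets of rational vectors

-- The ℤ-span of G; without function extensionality it is closed under pointwise equality by fiat.
data Lattice {d} (G : Pred (Vecℚ d) 0ℓ) : Pred (Vecℚ d) 0ℓ where
  gen  : ∀ {v} → G v → Lattice G v
  0v   : Lattice G (λ _ → 0ℚ)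
  add  : ∀ {u v} → Lattice G u → Lattice G v → Lattice G (u ⊕ v)
  neg  : ∀ {u} → Lattice G u → Lattice G (λ i → - u i)
  resp : ∀ {u v} → u ≗ v → Lattice G u → Lattice G v

module _ {d : ℕ} where

  private
    V : Set
    V = Vecℚ d
    variable
      G H K : Pred V 0ℓ
      u v : V

  infix 4 _⊑_ _≋_

  _⊑_ : Pred V 0ℓ → Pred V 0ℓ → Set
  G ⊑ H = G ⊆ Lattice H

  _≋_ : Pred V 0ℓ → Pred V 0ℓ → Set
  G ≋ H = G ⊑ H × H ⊑ G

  sub : Lattice G u → Lattice G v → Lattice G (u ⊖ v)
  sub l₁ l₂ = add l₁ (neg l₂)

  scaleℕ : ∀ n → Lattice G u → Lattice G (ιℚ (+ n) · u)
  scaleℕ {u = u} zero    _ = resp (λ i → sym (ℚ.*-zeroˡ (u i))) 0v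
  scaleℕ {u = u} (suc n) l = resp eq (add l (scaleℕ n l))
    where
    eq : u ⊕ (ιℚ (+ n) · u) ≗ ιℚ (+ suc n) · u
    eq i = begin
      u i + ιℚ (+ n) * u i   ≡⟨ solve 2 (λ x y → x :+ y :* x := (con 1ℚ :+ y) :* x) refl (u i) (ιℚ (+ n)) ⟩
      (1ℚ + ιℚ (+ n)) * u i  ≡⟨ cong (_* u i) (ιℚ-+ (+ 1) (+ n)) ⟨
      ιℚ (+ suc n) * u i     ∎
      where open ≡-Reasoning

  scale : ∀ z → Lattice G u → Lattice G (ιℚ z · u)
  scale (+ n)            l = scaleℕ n l
  scale {u = u} -[1+ n ] l = resp eq (neg (scaleℕ (suc n) l))
    where
    eq : (λ i → - (ιℚ (+ suc n) * u i)) ≗ ιℚ -[1+ n ] · u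
    eq i = trans (ℚ.neg-distribˡ-* (ιℚ (+ suc n)) (u i)) (cong (_* u i) (sym (ιℚ-neg (+ suc n))))

  Σ-closed : ∀ k (f : Fin k → V) → (∀ i → Lattice G (f i)) → Lattice G (λ r → Σℚ k (λ i → f i r))
  Σ-closed zero    f l = 0v
  Σ-closed (suc k) f l = add (l zero) (Σ-closed k (f ∘ suc) (l ∘ suc))

  Lattice-⊑ : G ⊑ H → Lattice G ⊆ Lattice H
  Lattice-⊑ G⊑H (gen g)    = G⊑H g
  Lattice-⊑ G⊑H 0v         = 0v
  Lattice-⊑ G⊑H (add u v)  = add (Lattice-⊑ G⊑H u) (Lattice-⊑ G⊑H v)
  Lattice-⊑ G⊑H (neg u)    = neg (Lattice-⊑ G⊑H u)
  Lattice-⊑ G⊑H (resp e u) = resp e (Lattice-⊑ G⊑H u)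

  ≋-sym : G ≋ H → H ≋ G
  ≋-sym (G⊑H , H⊑G) = H⊑G , G⊑H

  ≋-trans : G ≋ H → H ≋ K → G ≋ K
  ≋-trans (G⊑H , H⊑G) (H⊑K , K⊑H) = Lattice-⊑ H⊑K ∘ G⊑H , Lattice-⊑ H⊑G ∘ K⊑H

  ≐⇒≋ : G ≐ H → G ≋ H
  ≐⇒≋ (G⊆H , H⊆G) = gen ∘ G⊆H , gen ∘ H⊆G

  ∪-congˡ : ∀ R → G ≋ H → (G ∪ R) ≋ (H ∪ R)
  ∪-congˡ R (G⊑H , H⊑G) = [ Lattice-⊑ (gen ∘ inj₁) ∘ G⊑H , gen ∘ inj₂ ]′
                        , [ Lattice-⊑ (gen ∘ inj₁) ∘ H⊑G , gen ∘ inj₂ ]′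

  Units : ∀ {m} → Vec (Fin d) m → Pred V 0ℓ
  Units ℓs v = ∃ λ k → k ∈ ℓs × v ≡ unit k

  SupportedIn : ∀ {m} → Vec (Fin d) m → V → Set
  SupportedIn ℓs v = ∀ k → k ∈ ℓs ⊎ v k ≡ 0ℚ

  φ-StableOutside : ∀ {m} → Vec (Fin d) m → V → Set
  φ-StableOutside ℓs v = ∀ k → k ∈ ℓs ⊎ φ (v k) ≡ v k

  private
    variable
      m : ℕ
      ℓ : Fin d
      ℓs : Vec (Fin d) m

  integral-∈-Lattice-Units : (z : Fin d → ℤ) → SupportedIn ℓs (ιℚ ∘ z) → Lattice (Units ℓs) (ιℚ ∘ z)
  integral-∈-Lattice-Units {ℓs = ℓs} z supp = resp expand (Σ-closed d (λ k → ιℚ (z k) · unit k) term)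
    where
    term : ∀ k → Lattice (Units ℓs) (ιℚ (z k) · unit k)
    term k with supp k
    ... | inj₁ k∈ℓs = scale (z k) (gen (k , k∈ℓs , refl))
    ... | inj₂ zk≡0 = resp (λ r → trans (sym (ℚ.*-zeroˡ (unit k r))) (cong (_* unit k r) (sym zk≡0))) 0v
    expand : (λ r → Σℚ d (λ k → ιℚ (z k) * unit k r)) ≗ ιℚ ∘ z
    expand r = trans (Σℚ-cong d (λ k → trans (ℚ.*-comm (ιℚ (z k)) (unit k r)) (cong (_* ιℚ (z k)) (unit-sym k r))))
                     (Σℚ-unit d r (ιℚ ∘ z))

  φv⊖v-∈-Lattice-Units : φ-StableOutside ℓs u → Lattice (Units ℓs) (φv u ⊖ u)
  φv⊖v-∈-Lattice-Units {ℓs = ℓs} {u} stable = resp (sym ∘ φu-u≡) (integral-∈-Lattice-Units z supp)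
    where
    z : Fin d → ℤ
    z k = proj₁ (φ-differs-by-integer (u k))
    φu-u≡ : ∀ k → φ (u k) - u k ≡ ιℚ (z k)
    φu-u≡ k = trans (cong (_- u k) (proj₂ (φ-differs-by-integer (u k))))
                    (solve 2 (λ a b → (a :+ b) :- a := b) refl (u k) (ιℚ (z k)))
    supp : SupportedIn ℓs (ιℚ ∘ z)
    supp k with stable k
    ... | inj₁ k∈ℓs = inj₁ k∈ℓs
    ... | inj₂ fixed = inj₂ (trans (sym (φu-u≡ k)) (trans (cong (_- u k) fixed) (ℚ.+-inverseʳ (u k))))

  Lattice-φv : Units ℓs ⊑ K → φ-StableOutside ℓs u → Lattice K u → Lattice K (φv u)
  Lattice-φv {u = u} U⊑K stable l =
    resp (λ k → solve 2 (λ a b → a :+ (b :- a) := b) refl (u k) (φ (u k)))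
         (add l (Lattice-⊑ U⊑K (φv⊖v-∈-Lattice-Units stable)))

  Lattice-φv⁻ : Units ℓs ⊑ K → φ-StableOutside ℓs u → Lattice K (φv u) → Lattice K u
  Lattice-φv⁻ {u = u} U⊑K stable l =
    resp (λ k → solve 2 (λ a b → b :- (b :- a) := a) refl (u k) (φ (u k)))
         (sub l (Lattice-⊑ U⊑K (φv⊖v-∈-Lattice-Units stable)))

  supported-· : ∀ a → SupportedIn ℓs v → SupportedIn ℓs (a · v)
  supported-· a supp k = Sum.map₂ (λ vk≡0 → trans (cong (a *_) vk≡0) (ℚ.*-zeroʳ a)) (supp k)

  supported-⊕ : SupportedIn ℓs u → SupportedIn ℓs v → SupportedIn ℓs (u ⊕ v)
  supported-⊕ su sv k with su k | sv k
  ... | inj₁ k∈ℓs | _         = inj₁ k∈ℓs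
  ... | inj₂ _    | inj₁ k∈ℓs = inj₁ k∈ℓs
  ... | inj₂ uk≡0 | inj₂ vk≡0 = inj₂ (cong₂ _+_ uk≡0 vk≡0)

  supported-⊖ : SupportedIn ℓs u → SupportedIn ℓs v → SupportedIn ℓs (u ⊖ v)
  supported-⊖ su sv k with su k | sv k
  ... | inj₁ k∈ℓs | _         = inj₁ k∈ℓs
  ... | inj₂ _    | inj₁ k∈ℓs = inj₁ k∈ℓs
  ... | inj₂ uk≡0 | inj₂ vk≡0 = inj₂ (cong₂ _-_ uk≡0 vk≡0)

  supported-φv : SupportedIn ℓs v → SupportedIn ℓs (φv v)
  supported-φv supp k = Sum.map₂ (cong φ) (supp k)

  supported-∷⁻ : SupportedIn (ℓ ∷ ℓs) v → v ℓ ≡ 0ℚ → SupportedIn ℓs v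
  supported-∷⁻ supp vℓ≡0 k with supp k
  ... | inj₁ (here refl)  = inj₂ vℓ≡0
  ... | inj₁ (there k∈ℓs) = inj₁ k∈ℓs
  ... | inj₂ vk≡0         = inj₂ vk≡0

  supported⇒φ-stable : SupportedIn (ℓ ∷ ℓs) v → φ (v ℓ) ≡ v ℓ → φ-StableOutside ℓs v
  supported⇒φ-stable supp fixed k with supp k
  ... | inj₁ (here refl)  = inj₂ fixed
  ... | inj₁ (there k∈ℓs) = inj₁ k∈ℓs
  ... | inj₂ vk≡0         = inj₂ (trans (cong φ vk≡0) (sym vk≡0))

  unit-supported : SupportedIn (ℓ ∷ ℓs) (unit ℓ)
  unit-supported {ℓ} k with ℓ Fin.≟ k
  ... | yes refl = inj₁ (here refl)
  ... | no _     = inj₂ refl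

  -- One round of step 3

  record InnerInvariant (ℓ : Fin d) (ℓs : Vec (Fin d) m) (t : ℕ) (Z : V) (g : ℤ) : Set where
    field
      g-pos : 0ℤ ℤ.< g
      g≤t   : g ℤ.≤ + t
      pivot : ιℚ (+ t) * Z ℓ ≡ ιℚ g
      supp  : SupportedIn (ℓ ∷ ℓs) Z

  module InnerStep {ℓ : Fin d} {ℓs : Vec (Fin d) m} {t Z g x}
    (inv : InnerInvariant ℓ ℓs t Z g) (x-supp : SupportedIn (ℓ ∷ ℓs) x)
    (tⱼ : ℤ) (tⱼ≡ : ιℚ tⱼ ≡ ιℚ (+ t) * x ℓ)
    (α β : ℤ) (bezout : gcd g tⱼ ≡ α ℤ.* g ℤ.+ β ℤ.* tⱼ)
    (q₁ q₂ : ℤ) (g≡ : g ≡ q₁ ℤ.* gcd g tⱼ) (tⱼ≡q₂g′ : tⱼ ≡ q₂ ℤ.* gcd g tⱼ)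
    where

    open InnerInvariant inv

    g′ : ℤ
    g′ = gcd g tⱼ

    Z′ x′ Z₁ x₁ : V
    Z′ = (ιℚ α · Z) ⊕ (ιℚ β · x)
    x′ = (ιℚ q₁ · x) ⊖ (ιℚ q₂ · Z)
    Z₁ = φv Z′
    x₁ = φv x′

    T : ℚ
    T = ιℚ (+ t)

    g′-bounds : 0ℤ ℤ.< g′ × g′ ℤ.≤ g
    g′-bounds = 0<i⇒0<gcd[i,j]≤i tⱼ g-pos

    Z′-pivot : T * Z′ ℓ ≡ ιℚ g′
    Z′-pivot = begin
      T * (ιℚ α * Z ℓ + ιℚ β * x ℓ)
        ≡⟨ solve 5 (λ T a b z y → T :* (a :* z :+ b :* y) := a :* (T :* z) :+ b :* (T :* y))
             refl T (ιℚ α) (ιℚ β) (Z ℓ) (x ℓ) ⟩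
      ιℚ α * (T * Z ℓ) + ιℚ β * (T * x ℓ)   ≡⟨ cong₂ (λ p q → ιℚ α * p + ιℚ β * q) pivot (sym tⱼ≡) ⟩
      ιℚ α * ιℚ g + ιℚ β * ιℚ tⱼ            ≡⟨ ιℚ-lincomb α g β tⱼ ⟨
      ιℚ (α ℤ.* g ℤ.+ β ℤ.* tⱼ)             ≡⟨ cong ιℚ bezout ⟨
      ιℚ g′                                 ∎
      where open ≡-Reasoning

    x′-pivot : x′ ℓ ≡ 0ℚ
    x′-pivot = *-cancelˡ-≡-pos T (ιℚ-positive (ℤ.<-≤-trans g-pos g≤t)) (begin
      T * (ιℚ q₁ * x ℓ - ιℚ q₂ * Z ℓ)
        ≡⟨ solve 5 (λ T a b z y → T :* (a :* y :- b :* z) := a :* (T :* y) :- b :* (T :* z))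
             refl T (ιℚ q₁) (ιℚ q₂) (Z ℓ) (x ℓ) ⟩
      ιℚ q₁ * (T * x ℓ) - ιℚ q₂ * (T * Z ℓ)
        ≡⟨ cong₂ (λ p q → ιℚ q₁ * p - ιℚ q₂ * q) (sym tⱼ≡) pivot ⟩
      ιℚ q₁ * ιℚ tⱼ - ιℚ q₂ * ιℚ g
        ≡⟨ cong₂ (λ p q → ιℚ q₁ * p - ιℚ q₂ * q)
             (trans (cong ιℚ tⱼ≡q₂g′) (ιℚ-* q₂ g′)) (trans (cong ιℚ g≡) (ιℚ-* q₁ g′)) ⟩
      ιℚ q₁ * (ιℚ q₂ * ιℚ g′) - ιℚ q₂ * (ιℚ q₁ * ιℚ g′)
        ≡⟨ solve 4 (λ T a b c → a :* (b :* c) :- b :* (a :* c) := T :* con 0ℚ)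
             refl T (ιℚ q₁) (ιℚ q₂) (ιℚ g′) ⟩
      T * 0ℚ
        ∎)
      where open ≡-Reasoning

    Z′ℓ-fixed : φ (Z′ ℓ) ≡ Z′ ℓ
    Z′ℓ-fixed = uncurry 0<q≤1⇒φq≡q
      (t*q≡g⇒0<q≤1 t Z′-pivot (proj₁ g′-bounds) (ℤ.≤-trans (proj₂ g′-bounds) g≤t))

    Z′-supp : SupportedIn (ℓ ∷ ℓs) Z′
    Z′-supp = supported-⊕ (supported-· (ιℚ α) supp) (supported-· (ιℚ β) x-supp)

    x′-supp : SupportedIn (ℓ ∷ ℓs) x′
    x′-supp = supported-⊖ (supported-· (ιℚ q₁) x-supp) (supported-· (ιℚ q₂) supp)

    Z₁-invariant : InnerInvariant ℓ ℓs t Z₁ g′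
    Z₁-invariant = record
      { g-pos = proj₁ g′-bounds
      ; g≤t   = ℤ.≤-trans (proj₂ g′-bounds) g≤t
      ; pivot = trans (cong (T *_) Z′ℓ-fixed) Z′-pivot
      ; supp  = supported-φv Z′-supp
      }

    x₁-supp : SupportedIn ℓs x₁
    x₁-supp = supported-φv (supported-∷⁻ x′-supp x′-pivot)

    det≡1 : ιℚ α * ιℚ q₁ + ιℚ β * ιℚ q₂ ≡ 1ℚ
    det≡1 = trans (sym (ιℚ-lincomb α q₁ β q₂)) (cong ιℚ
      (bezout-cofactors≡1 {α = α} {β = β} {q₁ = q₁} {q₂ = q₂} (≢-sym (ℤ.<⇒≢ (proj₁ g′-bounds))) bezout g≡ tⱼ≡q₂g′))

    Z-from-Z′x′ : (ιℚ q₁ · Z′) ⊖ (ιℚ β · x′) ≗ Z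
    Z-from-Z′x′ i = begin
      ιℚ q₁ * (ιℚ α * Z i + ιℚ β * x i) - ιℚ β * (ιℚ q₁ * x i - ιℚ q₂ * Z i)
        ≡⟨ solve 6 (λ p a b q z y → p :* (a :* z :+ b :* y) :- b :* (p :* y :- q :* z) := (a :* p :+ b :* q) :* z)
             refl (ιℚ q₁) (ιℚ α) (ιℚ β) (ιℚ q₂) (Z i) (x i) ⟩
      (ιℚ α * ιℚ q₁ + ιℚ β * ιℚ q₂) * Z i   ≡⟨ cong (_* Z i) det≡1 ⟩
      1ℚ * Z i                              ≡⟨ ℚ.*-identityˡ (Z i) ⟩
      Z i                                   ∎
      where open ≡-Reasoning

    x-from-Z′x′ : (ιℚ q₂ · Z′) ⊕ (ιℚ α · x′) ≗ x
    x-from-Z′x′ i = begin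
      ιℚ q₂ * (ιℚ α * Z i + ιℚ β * x i) + ιℚ α * (ιℚ q₁ * x i - ιℚ q₂ * Z i)
        ≡⟨ solve 6 (λ p a b q z y → q :* (a :* z :+ b :* y) :+ a :* (p :* y :- q :* z) := (a :* p :+ b :* q) :* y)
             refl (ιℚ q₁) (ιℚ α) (ιℚ β) (ιℚ q₂) (Z i) (x i) ⟩
      (ιℚ α * ιℚ q₁ + ιℚ β * ιℚ q₂) * x i   ≡⟨ cong (_* x i) det≡1 ⟩
      1ℚ * x i                              ≡⟨ ℚ.*-identityˡ (x i) ⟩
      x i                                   ∎
      where open ≡-Reasoning

    exchange : ∀ {G} → Units ℓs ⊆ G → (G ∪ ｛ Z ｝) ∪ ｛ x ｝ ≋ (G ∪ ｛ Z₁ ｝) ∪ ｛ x₁ ｝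
    exchange {G} U⊆G = [ [ gen ∘ inj₁ ∘ inj₁ , (λ { refl → Z-old }) ]′ , (λ { refl → x-old }) ]′
                     , [ [ gen ∘ inj₁ ∘ inj₁ , (λ { refl → Z-new }) ]′ , (λ { refl → x-new }) ]′
      where
      Z′-stable = supported⇒φ-stable Z′-supp Z′ℓ-fixed
      x′-stable = supported⇒φ-stable x′-supp (trans (cong φ x′-pivot) (sym x′-pivot))
      New = (G ∪ ｛ Z₁ ｝) ∪ ｛ x₁ ｝
      Old = (G ∪ ｛ Z ｝) ∪ ｛ x ｝
      Z′-new : Lattice New Z′
      Z′-new = Lattice-φv⁻ (gen ∘ inj₁ ∘ inj₁ ∘ U⊆G) Z′-stable (gen (inj₁ (inj₂ refl)))
      x′-new : Lattice New x′
      x′-new = Lattice-φv⁻ (gen ∘ inj₁ ∘ inj₁ ∘ U⊆G) x′-stable (gen (inj₂ refl))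
      Z-old : Lattice New Z
      Z-old = resp Z-from-Z′x′ (sub (scale q₁ Z′-new) (scale β x′-new))
      x-old : Lattice New x
      x-old = resp x-from-Z′x′ (add (scale q₂ Z′-new) (scale α x′-new))
      Z-new : Lattice Old Z₁
      Z-new = Lattice-φv (gen ∘ inj₁ ∘ inj₁ ∘ U⊆G) Z′-stable
                (add (scale α (gen (inj₁ (inj₂ refl)))) (scale β (gen (inj₂ refl))))
      x-new : Lattice Old x₁
      x-new = Lattice-φv (gen ∘ inj₁ ∘ inj₁ ∘ U⊆G) x′-stable
                (sub (scale q₁ (gen (inj₂ refl))) (scale q₂ (gen (inj₁ (inj₂ refl)))))

  peel : ∀ (U : Pred V 0ℓ) {k} (x Z : V) (xs : Vec V k) →
         (U ∪ (_∈ x ∷ xs)) ∪ ｛ Z ｝ ≐ ((U ∪ (_∈ xs)) ∪ ｛ Z ｝) ∪ ｛ x ｝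
  peel U x Z xs =
    [ [ inj₁ ∘ inj₁ ∘ inj₁ , (λ { (here refl) → inj₂ refl ; (there v∈xs) → inj₁ (inj₁ (inj₂ v∈xs)) }) ]′ , inj₁ ∘ inj₂ ]′ ,
    [ [ [ inj₁ ∘ inj₁ , inj₁ ∘ inj₂ ∘ there ]′ , inj₂ ]′ , (λ { refl → inj₁ (inj₂ (here refl)) }) ]′

  inner-loop : ∀ {t Z g k} {xs : Vec V k} {Zf xs′} → Inner ℓ t Z g xs Zf xs′ →
               InnerInvariant ℓ ℓs t Z g → All (SupportedIn (ℓ ∷ ℓs)) xs →
               ((Units ℓs ∪ (_∈ xs)) ∪ ｛ Z ｝ ≋ (Units ℓs ∪ (_∈ xs′)) ∪ ｛ Zf ｝) × All (SupportedIn ℓs) xs′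
  inner-loop done inv [] = ≐⇒≋ (id , id) , []
  inner-loop {ℓs = ℓs} {Z = Z} {xs = x ∷ xs} {Zf}
             (step tⱼ tⱼ≡ α β bezout q₁ q₂ g≡ tⱼ≡q₂g′ rest) inv (x-supp ∷ xs-supp) =
    let rest≋ , xs′-supp = inner-loop rest Z₁-invariant xs-supp in
    ≋-trans (≐⇒≋ (peel (Units ℓs) x Z xs))
    (≋-trans (exchange {Units ℓs ∪ (_∈ xs)} inj₁)
    (≋-trans (∪-congˡ ｛ x₁ ｝ rest≋)
             (≋-sym (≐⇒≋ (peel (Units ℓs) x₁ Zf _))))) ,
    x₁-supp ∷ xs′-supp
    where open InnerStep inv x-supp tⱼ tⱼ≡ α β bezout q₁ q₂ g≡ tⱼ≡q₂g′

  Units-∷ : ∀ (R : Pred V 0ℓ) → Units (ℓ ∷ ℓs) ∪ R ≐ (Units ℓs ∪ R) ∪ ｛ unit ℓ ｝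
  Units-∷ R =
    [ (λ { (k , here refl , refl) → inj₂ refl ; (k , there k∈ℓs , v≡) → inj₁ (inj₁ (k , k∈ℓs , v≡)) }) , inj₁ ∘ inj₂ ]′ ,
    [ [ (λ { (k , k∈ℓs , v≡) → inj₁ (k , there k∈ℓs , v≡) }) , inj₂ ]′ , (λ { refl → inj₁ (_ , here refl , refl) }) ]′

  ∈-∷ : ∀ {k} (y : V) (ys : Vec V k) → (_∈ ys) ∪ ｛ y ｝ ≐ (_∈ y ∷ ys)
  ∈-∷ y ys = [ there , (λ { refl → here refl }) ]′ , (λ { (here refl) → inj₂ refl ; (there p) → inj₁ p })

  outer-loop : ∀ {k} {xs : Vec V k} {Ys} → Outer ℓs xs Ys → All (SupportedIn ℓs) xs →
               Units ℓs ∪ (_∈ xs) ≋ (_∈ Ys)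
  outer-loop done xs-supp =
    [ (λ { (_ , () , _) }) , (λ v∈xs → resp (sym ∘ vanishes (All.lookup xs-supp v∈xs)) 0v) ]′ , λ ()
    where
    vanishes : SupportedIn [] v → ∀ k → v k ≡ 0ℚ
    vanishes supp k with supp k
    ... | inj₂ vk≡0 = vk≡0
  outer-loop {ℓs = ℓ ∷ ℓs} {xs = xs} (step {Zf = Zf} {Ys = Ys} t 0<t run rest) xs-supp =
    let inner≋ , xs′-supp = inner-loop run unit-invariant xs-supp in
    ≋-trans (≐⇒≋ (Units-∷ (_∈ xs)))
    (≋-trans inner≋
    (≋-trans (∪-congˡ ｛ Zf ｝ (outer-loop rest xs′-supp))
             (≐⇒≋ (∈-∷ Zf Ys))))
    where
    unit-invariant : InnerInvariant ℓ ℓs t (unit ℓ) (+ t)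
    unit-invariant = record
      { g-pos = ℤ.+<+ 0<t
      ; g≤t   = ℤ.≤-refl
      ; pivot = trans (cong (ιℚ (+ t) *_) (unit-diag ℓ)) (ℚ.*-identityʳ (ιℚ (+ t)))
      ; supp  = unit-supported
      }

-- Matrices, lattices of columns and the theorem

Columns : ∀ {d k} → Mat d k → Pred (Vecℚ d) 0ℓ
Columns M v = ∃ λ c → v ≡ λ r → M r c

∈L⇒Lattice : ∀ {d k} (M : Mat d k) {v} → v ∈L M → Lattice (Columns M) v
∈L⇒Lattice {k = k} M (c , v≡) =
  resp (λ r → sym (v≡ r)) (Σ-closed k (λ i r → ιℚ (c i) * M r i) (λ i → scale (c i) (gen (i , refl))))

Lattice⇒∈L : ∀ {d k} (M : Mat d k) {v} → Lattice (Columns M) v → v ∈L M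
Lattice⇒∈L {k = k} M (gen (i , refl)) = δ , λ r → sym (begin
    Σℚ k (λ j → ιℚ (δ j) * M r j)  ≡⟨ Σℚ-cong k (λ j → cong (_* M r j) (ιℚ-δ j)) ⟩
    Σℚ k (λ j → unit i j * M r j)  ≡⟨ Σℚ-unit k i (M r) ⟩
    M r i                          ∎)
  where
  open ≡-Reasoning
  δ : Fin k → ℤ
  δ j = if does (i Fin.≟ j) then + 1 else 0ℤ
  ιℚ-δ : ∀ j → ιℚ (δ j) ≡ unit i j
  ιℚ-δ j with does (i Fin.≟ j)
  ... | true  = refl
  ... | false = refl
Lattice⇒∈L {k = k} M 0v =
  (λ _ → 0ℤ) , λ r → sym (trans (Σℚ-cong k (λ i → ℚ.*-zeroˡ (M r i))) (Σℚ-zero k))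
Lattice⇒∈L {k = k} M (add l₁ l₂) with Lattice⇒∈L M l₁ | Lattice⇒∈L M l₂
... | c₁ , e₁ | c₂ , e₂ = (λ i → c₁ i ℤ.+ c₂ i) , λ r → begin
    _                                                            ≡⟨ cong₂ _+_ (e₁ r) (e₂ r) ⟩
    Σℚ k (λ i → ιℚ (c₁ i) * M r i) + Σℚ k (λ i → ιℚ (c₂ i) * M r i)  ≡⟨ Σℚ-+ k _ _ ⟨
    Σℚ k (λ i → ιℚ (c₁ i) * M r i + ιℚ (c₂ i) * M r i)              ≡⟨ Σℚ-cong k (λ i → distrib (c₁ i) (c₂ i) (M r i)) ⟩
    Σℚ k (λ i → ιℚ (c₁ i ℤ.+ c₂ i) * M r i)                          ∎
  where
  open ≡-Reasoning
  distrib : ∀ a b x → ιℚ a * x + ιℚ b * x ≡ ιℚ (a ℤ.+ b) * x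
  distrib a b x = trans (sym (ℚ.*-distribʳ-+ x (ιℚ a) (ιℚ b))) (cong (_* x) (sym (ιℚ-+ a b)))
Lattice⇒∈L {k = k} M (neg l) with Lattice⇒∈L M l
... | c , e = (λ i → ℤ.- c i) , λ r → begin
    _                                      ≡⟨ cong -_ (e r) ⟩
    - Σℚ k (λ i → ιℚ (c i) * M r i)        ≡⟨ Σℚ-neg k _ ⟨
    Σℚ k (λ i → - (ιℚ (c i) * M r i))      ≡⟨ Σℚ-cong k (λ i → negate (c i) (M r i)) ⟩
    Σℚ k (λ i → ιℚ (ℤ.- c i) * M r i)      ∎
  where
  open ≡-Reasoning
  negate : ∀ a x → - (ιℚ a * x) ≡ ιℚ (ℤ.- a) * x
  negate a x = trans (ℚ.neg-distribˡ-* (ιℚ a) x) (cong (_* x) (sym (ιℚ-neg a)))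
Lattice⇒∈L M (resp u≗v l) with Lattice⇒∈L M l
... | c , e = c , λ r → trans (sym (u≗v r)) (e r)

same-lattice : ∀ {d k l} (M : Mat d k) (N : Mat d l) → Columns M ≋ Columns N →
               ∀ v → (v ∈L M → v ∈L N) × (v ∈L N → v ∈L M)
same-lattice M N (M⊑N , N⊑M) v = Lattice⇒∈L N ∘ Lattice-⊑ M⊑N ∘ ∈L⇒Lattice M
                               , Lattice⇒∈L M ∘ Lattice-⊑ N⊑M ∘ ∈L⇒Lattice N

infixr 7 _⊙_

_⊙_ : ∀ {e d} → Mat e d → Vecℚ d → Vecℚ e
(M ⊙ v) r = Σℚ _ (λ i → M r i * v i)

Image : ∀ {e d} → Mat e d → Pred (Vecℚ d) 0ℓ → Pred (Vecℚ e) 0ℓ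
Image M G w = ∃ λ u → G u × w ≡ M ⊙ u

Lattice-image : ∀ {e d} (M : Mat e d) {G u} → Lattice G u → Lattice (Image M G) (M ⊙ u)
Lattice-image M (gen g) = gen (_ , g , refl)
Lattice-image {d = d} M 0v =
  resp (λ r → sym (trans (Σℚ-cong d (λ i → ℚ.*-zeroʳ (M r i))) (Σℚ-zero d))) 0v
Lattice-image {d = d} M (add {u} {v} l₁ l₂) =
  resp (λ r → trans (sym (Σℚ-+ d _ _)) (Σℚ-cong d (λ i → sym (ℚ.*-distribˡ-+ (M r i) (u i) (v i)))))
       (add (Lattice-image M l₁) (Lattice-image M l₂))
Lattice-image {d = d} M (neg {u} l) =
  resp (λ r → trans (sym (Σℚ-neg d _)) (Σℚ-cong d (λ i → ℚ.neg-distribʳ-* (M r i) (u i))))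
       (neg (Lattice-image M l))
Lattice-image {d = d} M (resp u≗v l) =
  resp (λ r → Σℚ-cong d (λ i → cong (M r i *_) (u≗v i))) (Lattice-image M l)

Image-⊑ : ∀ {e d} (M : Mat e d) {G H} → G ⊑ H → Image M G ⊑ Image M H
Image-⊑ M G⊑H (u , g , refl) = Lattice-image M (G⊑H g)

Image-≋ : ∀ {e d} (M : Mat e d) {G H} → G ≋ H → Image M G ≋ Image M H
Image-≋ M (G⊑H , H⊑G) = Image-⊑ M G⊑H , Image-⊑ M H⊑G

⊙-unit : ∀ {e d} (M : Mat e d) k → M ⊙ unit k ≗ λ r → M r k
⊙-unit {d = d} M k r = trans (Σℚ-cong d (λ i → ℚ.*-comm (M r i) (unit k i))) (Σℚ-unit d k (M r))

Columns-⊗ : ∀ {e d k} (B : Mat e d) (Ys : Vec (Vecℚ d) k) → Columns (B ⊗ colsMat Ys) ≋ Image B (_∈ Ys)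
Columns-⊗ B Ys = (λ { (c , refl) → gen (lookup Ys c , ∈-lookup c Ys , refl) })
               , (λ { (u , u∈Ys , refl) → gen (Any.index u∈Ys , cong (B ⊙_) (lookup-index u∈Ys)) })

matCols-≐ : ∀ {d k} (M : Mat d k) → (_∈ matCols M) ≐ Columns M
matCols-≐ {k = zero}  M = (λ ()) , (λ { (() , _) })
matCols-≐ {k = suc k} M =
  (λ { (here refl) → zero , refl ; (there v∈) → Product.map suc id (proj₁ (matCols-≐ M′) v∈) }) ,
  (λ { (zero , refl) → here refl ; (suc c , refl) → there (proj₂ (matCols-≐ M′) (c , refl)) })
  where
  M′ : Mat _ k
  M′ r c = M r (suc c)

φv-columns : ∀ {d k m} {ℓs : Vec (Fin d) m} (X : Mat d k) → (∀ j → j ∈ ℓs) →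
             Units ℓs ∪ Columns X ≋ Units ℓs ∪ (_∈ map φv (matCols X))
φv-columns {ℓs = ℓs} X covers =
  [ gen ∘ inj₁ , (λ column → Lattice-φv⁻ (gen ∘ inj₁) stable (gen (inj₂ (∈-map⁺ φv (proj₂ (matCols-≐ X) column))))) ]′ ,
  [ gen ∘ inj₁ , (λ v∈ → let x , x∈ , v≡ = fromAny (map⁻ v∈) in
                         subst (Lattice _) (sym v≡) (Lattice-φv (gen ∘ inj₁) stable (gen (inj₂ (proj₁ (matCols-≐ X) x∈))))) ]′
  where
  stable : ∀ {u} → φ-StableOutside ℓs u
  stable k = inj₁ (covers k)

Columns-split : ∀ {d p q n m} (M : Mat d n) (col : Fin p ⊎ Fin q → Fin n) → (∀ c → ∃ λ s → col s ≡ c) →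
  (X : Mat p q) → (∀ r j → ((λ r i → M r (col (inj₁ i))) ⊗ X) r j ≡ M r (col (inj₂ j))) →
  {ℓs : Vec (Fin p) m} → (∀ k → k ∈ ℓs) →
  Image (λ r i → M r (col (inj₁ i))) (Units ℓs ∪ Columns X) ≋ Columns M
Columns-split {d} {p} {q} M col col-surj X BX≡C {ℓs} covers =
  (λ { (_ , inj₁ (k , _ , refl) , refl) → resp (λ r → sym (⊙-unit B k r)) (gen (col (inj₁ k) , refl))
     ; (_ , inj₂ (j , refl) , refl)     → resp (λ r → sym (BX≡C r j)) (gen (col (inj₂ j) , refl)) }) ,
  (λ { (c , refl) → from-col c (col-surj c) })
  where
  B : Mat d p
  B r i = M r (col (inj₁ i))
  from-col : ∀ c → ∃ (λ s → col s ≡ c) → Lattice (Image B (Units ℓs ∪ Columns X)) (λ r → M r c)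
  from-col c (inj₁ k , eq) = resp (λ r → trans (⊙-unit B k r) (cong (M r) eq))
                                  (gen (unit k , inj₁ (k , covers k , refl) , refl))
  from-col c (inj₂ j , eq) = resp (λ r → trans (BX≡C r j) (cong (M r) eq))
                                  (gen ((λ r → X r j) , inj₂ (j , refl) , refl))

injective⇒surjective : ∀ {m n} (f : Fin m → Fin n) → Injective _≡_ _≡_ f → n ℕ.≤ m →
                        ∀ k → ∃ λ i → f i ≡ k
injective⇒surjective {m} {suc n} f f-inj n≤m k with Fin.any? (λ i → f i Fin.≟ k)
... | yes hit = hit
... | no miss = contradiction (ℕ.≤-trans n≤m (Fin.injective⇒≤ f′-inj)) ℕ.1+n≰n
  where
  f≢k : ∀ i → k ≢ f i
  f≢k i k≡fi = miss (i , sym k≡fi)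
  f′ : Fin m → Fin n
  f′ i = punchOut (f≢k i)
  f′-inj : Injective _≡_ _≡_ f′
  f′-inj {i} {j} eq = f-inj (Fin.punchOut-injective (f≢k i) (f≢k j) eq)

⊎-injective⇒surjective : ∀ {p q n} (f : Fin p ⊎ Fin q → Fin n) → Injective _≡_ _≡_ f → n ℕ.≤ p ℕ.+ q →
                          ∀ k → ∃ λ s → f s ≡ k
⊎-injective⇒surjective {p} {q} f f-inj n≤p+q k =
  Product.map (splitAt p) id (injective⇒surjective (f ∘ splitAt p) f∘split-inj n≤p+q k)
  where
  f∘split-inj : Injective _≡_ _≡_ (f ∘ splitAt p)
  f∘split-inj {i} {j} eq = begin
    i                      ≡⟨ Fin.join-splitAt p q i ⟨
    join p q (splitAt p i) ≡⟨ cong (join p q) (f-inj eq) ⟩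
    join p q (splitAt p j) ≡⟨ Fin.join-splitAt p q j ⟩
    j                      ∎
    where open ≡-Reasoning

lookup-injective⇒∈ : ∀ {n} (ℓs : Vec (Fin n) n) → (∀ i j → lookup ℓs i ≡ lookup ℓs j → i ≡ j) → ∀ k → k ∈ ℓs
lookup-injective⇒∈ ℓs inj k with injective⇒surjective (lookup ℓs) (λ {i} {j} → inj i j) ℕ.≤-refl k
... | i , refl = ∈-lookup i ℓs

lemma5 : ∀ {d n : ℕ} (A : MatZ d n) → d ℕ.< n →
    (col : Fin d ⊎ Fin (n ∸ d) → Fin n) → Injective _≡_ _≡_ col →
    LinIndep (castMat (λ r i → A r (col (inj₁ i)))) →
    (X : Mat d (n ∸ d)) →
    (∀ r j → (castMat (λ r i → A r (col (inj₁ i))) ⊗ X) r j ≡ castMat (λ r j → A r (col (inj₂ j))) r j) →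
    (ℓs : Vec (Fin d) d) → (∀ i j → lookup ℓs i ≡ lookup ℓs j → i ≡ j) →
    (Ys : Vec (Vecℚ d) d) → Outer ℓs (map φv (matCols X)) Ys →
    ∀ (v : Vecℚ d) →
      (v ∈L (castMat (λ r i → A r (col (inj₁ i))) ⊗ colsMat Ys) → v ∈L castMat A) ×
      (v ∈L castMat A → v ∈L (castMat (λ r i → A r (col (inj₁ i))) ⊗ colsMat Ys))
lemma5 {d} {n} A _ col col-inj _ X BX≡C ℓs ℓs-inj Ys run =
  same-lattice (B ⊗ colsMat Ys) (castMat A)
    (≋-trans (Columns-⊗ B Ys)
    (≋-trans (Image-≋ B (≋-sym (outer-loop run (All.universal (λ _ k → inj₁ (covers k)) _))))
    (≋-trans (Image-≋ B (≋-sym (φv-columns X covers)))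
             (Columns-split (castMat A) col col-surj X BX≡C covers))))
  where
  B : Mat d d
  B = castMat (λ r i → A r (col (inj₁ i)))
  covers : ∀ k → k ∈ ℓs
  covers = lookup-injective⇒∈ ℓs ℓs-inj
  col-surj : ∀ c → ∃ λ s → col s ≡ c
  col-surj = ⊎-injective⇒surjective col col-inj (ℕ.m≤n+m∸n n d)
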